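{- For $n$ large enough and every integer $k \geq 4\log_2 n + 2$, Breaker has a winning strategy in the game $\mathcal{H}(T_k) = \mathcal{H}(T_k,n)$ for any tournament $T_k$ on $k$ vertices.
   Context: A tournament is a directed graph in which every pair of distinct vertices is joined by exactly one directed edge. For a tournament $T_k$ on $k$ vertices and an integer $n$, $\mathcal{H}(T_k,n)$ is the $(2:1)$ Maker--Breaker game $(X,\mathcal{F}(T_k))$ with board $X := \{(u,v) : u,v \in V(K_n),\ u\neq v\}$ (all $n(n-1)$ ordered pairs of distinct vertices of an $n$-vertex set) and winning sets $\mathcal{F}(T_k) := \{ S \subseteq X : S \text{ is (the arc set of) a copy of } T_k\}$. In an $(a:b)$ Maker--Breaker game, Maker and Breaker alternately claim previously unclaimed elements of the board, Maker going first, Maker claiming $a$ elements and Breaker $b$ elements per round; Maker wins if she claims all elements of some winning set, and otherwise Breaker wins. -}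

module Defs where

open import Data.Nat using (ℕ)
open import Data.Fin using (Fin)
open import Data.Product using (_×_; _,_; Σ; ∃)
open import Data.Sum using (_⊎_)
open import Data.List using (List; _∷_; [])
open import Data.List.Membership.Propositional using (_∈_; _∉_)
open import Relation.Binary.PropositionalEquality using (_≡_; _≢_)
open import Relation.Nullary using (¬_)
open import Function.Definitions using (Injective)

record Tournament (k : ℕ) : Set₁ where
  field
    Arc     : Fin k → Fin k → Set
    irrefl  : ∀ a → ¬ Arc a a
    asym    : ∀ a b → Arc a b → ¬ Arc b a
    total   : ∀ a b → a ≢ b → Arc a b ⊎ Arc b a
open Tournament public

Pair : ℕ → Set
Pair n = Fin n × Fin n

IsBoardElem : {n : ℕ} → Pair n → Set
IsBoardElem (u , v) = u ≢ v

Free : {n : ℕ} → List (Pair n) → List (Pair n) → Pair n → Set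
Free M B x = IsBoardElem x × x ∉ M × x ∉ B

NoFree : {n : ℕ} → List (Pair n) → List (Pair n) → Set
NoFree M B = ∀ x → ¬ Free M B x

ContainsCopy : {k n : ℕ} → Tournament k → List (Pair n) → Set
ContainsCopy {k} {n} T M =
  Σ (Fin k → Fin n) λ φ → Injective _≡_ _≡_ φ × (∀ a b → Arc T a b → (φ a , φ b) ∈ M)

-- BreakerWins T M B : in position (M , B) with Maker to move, Breaker has a
-- winning strategy in the (2:1) Maker–Breaker game whose winning sets are the
-- copies of T.  Being an inductive type, a proof
-- is exactly a (finite) Breaker strategy tree answering every Maker move.
mutual
  data BreakerWins {k n : ℕ} (T : Tournament k) (M B : List (Pair n)) : Set where
    node : (∀ x y → Free M B x → Free M B y → x ≢ y → AfterMaker T (x ∷ y ∷ M) B)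
         → (∀ x → Free M B x → (∀ z → Free M B z → z ≡ x) → AfterMaker T (x ∷ M) B)
         → BreakerWins T M B

  data AfterMaker {k n : ℕ} (T : Tournament k) (M B : List (Pair n)) : Set where
    full  : ¬ ContainsCopy T M → NoFree M B → AfterMaker T M B
    reply : ¬ ContainsCopy T M → (x : Pair n) → Free M B x
          → BreakerWins T M (x ∷ B) → AfterMaker T M B

BreakerWinsH : {k : ℕ} → Tournament k → ℕ → Set
BreakerWinsH T n = BreakerWins {n = n} T [] []

-- Breaker plays a potential strategy in the style of Erdős–Selfridge and Beck, adapted to the bias (2:1).
-- A copy of T that Breaker has not touched and in which Maker owns c arcs is worth weight c ≈ 2·√2^c;
-- the potential Φ is the total worth of all copies, and the danger D z of a free arc z is the worth of
-- the untouched copies through it.  Since weight (c + 2) = 2 · weight c and 2 · weight (c + 1) ≤ 3 · weight c,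
-- two Maker arcs x and y raise 2Φ by at most D x + D y, and Breaker's answer, a free arc z of maximal
-- danger, lowers Φ by exactly D z.  Hence Φ + D z < weight N for every free z after each Breaker move,
-- where N = k(k-1)/2, and so Φ < weight N after each Maker move, whereas a copy owned by Maker alone is
-- worth weight N.  At the start Φ + D z ≤ 4nᵏ, which is below weight N ≈ 2^(N/2 + 1) once n⁴ ≤ 2^(k-2).

module Submission where

open import Defs
open import Data.Nat using (ℕ; zero; suc; _+_; _*_; _^_; _∸_; _≤_; _<_; z≤n; s≤s; _≤?_)
open import Data.Nat.Properties hiding (_≟_; <-irrefl; <-asym; suc-injective)
open import Data.Nat.ListAction using (sum)
open import Data.Nat.Solver using (module +-*-Solver)
open import Algebra.Properties.CommutativeSemigroup +-commutativeSemigroup using (interchange; x∙yz≈y∙xz)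
open import Data.Fin using (Fin; zero; suc; _≟_) renaming (_<_ to _<ᶠ_)
open import Data.Fin.Properties using (suc-injective; <-irrefl; <-asym)
open import Data.Product using (Σ; ∃; _×_; _,_; proj₁; proj₂; swap)
import Data.Product as Product
open import Data.Product.Properties using (≡-dec; ,-injective)
open import Data.Sum using (_⊎_; inj₁; inj₂)
open import Data.List using (List; []; _∷_; [_]; map; _++_; length; filter; allFin; cartesianProductWith; cartesianProduct)
open import Data.List.Properties using (map-cong; length-map; length-++; length-filter; length-tabulate; filter-some)
open import Data.List.Membership.Propositional using (_∈_; _∉_; lose)
open import Data.List.Membership.Propositional.Properties
  using (∈-map⁺; ∈-map⁻; ∈-++⁻; ∈-filter⁺; ∈-allFin; ∈-cartesianProductWith⁺; ∈-cartesianProduct⁺)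
open import Data.List.Relation.Unary.Any as Any using (Any; here; there; any?)
open import Data.List.Relation.Unary.Any.Properties using (¬Any[])
open import Data.List.Relation.Unary.All as All using (All; []; _∷_)
open import Data.List.Relation.Unary.All.Properties as All using (All¬⇒¬Any; all-filter)
open import Data.List.Relation.Unary.Unique.Propositional using (Unique; []; _∷_)
import Data.List.Relation.Unary.Unique.Propositional.Properties as Unique
open import Data.List.Relation.Unary.Unique.DecPropositional using (unique?)
open import Data.List.Relation.Binary.Subset.Propositional using (_⊆_)
open import Data.List.Relation.Binary.Disjoint.Propositional using (Disjoint)
import Data.List.Relation.Binary.Sublist.Propositional as Sublist
import Data.List.Relation.Binary.Sublist.Propositional.Properties as Sublist
open import Data.List.Extrema.Nat using (argmax; argmax-all; f[⊥]≤f[argmax]; f[xs]≤f[argmax])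
open import Data.Vec using (Vec; []; _∷_; lookup; tabulate)
open import Data.Vec.Properties using (lookup∘tabulate)
open import Function using (_∘_; id)
open import Level using (0ℓ)
open import Relation.Nullary using (Dec; ¬_; yes; no; contradiction)
open import Relation.Nullary.Decidable using (_×-dec_; ¬?)
open import Relation.Unary using (Pred; Decidable; ∁)
open import Relation.Binary using (DecidableEquality)
open import Relation.Binary.PropositionalEquality
  using (_≡_; _≢_; refl; sym; trans; cong; cong₂; subst; module ≡-Reasoning)

open +-*-Solver

weight : ℕ → ℕ
weight 0 = 2
weight 1 = 3
weight (suc (suc c)) = 2 * weight c

2*weight-suc≤3*weight : ∀ c → 2 * weight (suc c) ≤ 3 * weight c
2*weight-suc≤3*weight 0 = ≤-refl
2*weight-suc≤3*weight 1 = s≤s (s≤s (s≤s (s≤s (s≤s (s≤s (s≤s (s≤s z≤n)))))))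
2*weight-suc≤3*weight (suc (suc c)) = begin
  2 * (2 * weight (suc c)) ≡⟨ *-comm 2 (2 * weight (suc c)) ⟩
  2 * weight (suc c) * 2   ≤⟨ *-monoˡ-≤ 2 (2*weight-suc≤3*weight c) ⟩
  3 * weight c * 2         ≡⟨ solve 1 (λ w → con 3 :* w :* con 2 := con 3 :* (con 2 :* w)) refl (weight c) ⟩
  3 * (2 * weight c)       ∎
  where open ≤-Reasoning

weight-suc≤2*weight : ∀ c → weight (suc c) ≤ 2 * weight c
weight-suc≤2*weight c = *-cancelˡ-≤ 2 (begin
  2 * weight (suc c)  ≤⟨ 2*weight-suc≤3*weight c ⟩
  3 * weight c        ≤⟨ *-monoˡ-≤ (weight c) (n≤1+n 3) ⟩
  4 * weight c        ≡⟨ *-assoc 2 2 (weight c) ⟩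
  2 * (2 * weight c)  ∎)
  where open ≤-Reasoning

weight≤weight-suc : ∀ c → weight c ≤ weight (suc c)
weight≤weight-suc 0 = s≤s (s≤s z≤n)
weight≤weight-suc 1 = s≤s (s≤s (s≤s z≤n))
weight≤weight-suc (suc (suc c)) = *-monoʳ-≤ 2 (weight≤weight-suc c)

weight-mono-≤ : ∀ {c d} → c ≤ d → weight c ≤ weight d
weight-mono-≤ {d = zero} z≤n = ≤-refl
weight-mono-≤ {d = suc d} c≤1+d with m≤n⇒m<n∨m≡n c≤1+d
... | inj₁ c<1+d = ≤-trans (weight-mono-≤ (≤-pred c<1+d)) (weight≤weight-suc d)
... | inj₂ refl = ≤-refl

2^[c+2]≤weight² : ∀ c → 2 ^ (c + 2) ≤ weight c ^ 2
2^[c+2]≤weight² 0 = s≤s (s≤s (s≤s (s≤s z≤n)))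
2^[c+2]≤weight² 1 = s≤s (s≤s (s≤s (s≤s (s≤s (s≤s (s≤s (s≤s z≤n)))))))
2^[c+2]≤weight² (suc (suc c)) = begin
  2 * (2 * 2 ^ (c + 2)) ≤⟨ *-monoʳ-≤ 2 (*-monoʳ-≤ 2 (2^[c+2]≤weight² c)) ⟩
  2 * (2 * weight c ^ 2) ≡⟨ solve 1 (λ w → con 2 :* (con 2 :* (w :^ 2)) := (con 2 :* w) :^ 2) refl (weight c) ⟩
  (2 * weight c) ^ 2     ∎
  where open ≤-Reasoning

weight-claim₁ : ∀ {i} c → i ≤ 1 → weight (i + c) ≤ weight c + i * weight c
weight-claim₁ c z≤n = m≤m+n (weight c) 0
weight-claim₁ c (s≤s z≤n) = weight-suc≤2*weight c

weight-claim₂ : ∀ {i j} c → i ≤ 1 → j ≤ 1 →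
             weight (i + (j + c)) + weight (i + (j + c)) ≤ (weight c + i * weight c) + (weight c + j * weight c)
weight-claim₂ c z≤n z≤n = ≤-reflexive (solve 1 (λ w → w :+ w := (w :+ con 0) :+ (w :+ con 0)) refl (weight c))
weight-claim₂ c (s≤s z≤n) z≤n = begin
  weight (suc c) + weight (suc c) ≡⟨ solve 1 (λ w → w :+ w := con 2 :* w) refl (weight (suc c)) ⟩
  2 * weight (suc c)              ≤⟨ 2*weight-suc≤3*weight c ⟩
  3 * weight c                    ≡⟨ solve 1 (λ w → con 3 :* w := (w :+ con 1 :* w) :+ (w :+ con 0)) refl (weight c) ⟩
  (weight c + 1 * weight c) + (weight c + 0 * weight c) ∎
  where open ≤-Reasoning
weight-claim₂ c z≤n (s≤s z≤n) =
  ≤-trans (weight-claim₂ c (s≤s z≤n) z≤n) (≤-reflexive (+-comm (weight c + 1 * weight c) (weight c + 0 * weight c)))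
weight-claim₂ c (s≤s z≤n) (s≤s z≤n) =
  ≤-reflexive (solve 1 (λ w → con 2 :* w :+ con 2 :* w := (w :+ con 1 :* w) :+ (w :+ con 1 :* w)) refl (weight c))

8+[3+t][5+t]<2N+4 : ∀ t N → 2 * N + (5 + t) ≡ (5 + t) * (5 + t) → 8 + (3 + t) * (5 + t) < 2 * N + 4
8+[3+t][5+t]<2N+4 t N e = +-cancelʳ-≤ (5 + t) _ _ (begin
  suc (8 + (3 + t) * (5 + t)) + (5 + t)      ≤⟨ m≤m+n _ t ⟩
  suc (8 + (3 + t) * (5 + t)) + (5 + t) + t  ≡⟨ solve 1 (λ t → con 1 :+ (con 8 :+ (con 3 :+ t) :* (con 5 :+ t)) :+ (con 5 :+ t) :+ t
                                                         := (con 5 :+ t) :* (con 5 :+ t) :+ con 4) refl t ⟩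
  (5 + t) * (5 + t) + 4                      ≡⟨ cong (_+ 4) (sym e) ⟩
  2 * N + (5 + t) + 4                        ≡⟨ solve 2 (λ a b → a :+ b :+ con 4 := a :+ con 4 :+ b) refl (2 * N) (5 + t) ⟩
  2 * N + 4 + (5 + t)                        ∎)
  where open ≤-Reasoning

2^[2c+4]≤weight⁴ : ∀ c → 2 ^ (2 * c + 4) ≤ weight c ^ 4
2^[2c+4]≤weight⁴ c = begin
  2 ^ (2 * c + 4)        ≡⟨ cong (2 ^_) (solve 1 (λ c → con 2 :* c :+ con 4 := (c :+ con 2) :* con 2) refl c) ⟩
  2 ^ ((c + 2) * 2)      ≡⟨ ^-*-assoc 2 (c + 2) 2 ⟨
  (2 ^ (c + 2)) ^ 2      ≤⟨ ^-monoˡ-≤ 2 (2^[c+2]≤weight² c) ⟩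
  (weight c ^ 2) ^ 2     ≡⟨ ^-*-assoc (weight c) 2 2 ⟩
  weight c ^ 4           ∎
  where open ≤-Reasoning

[4*n^k]⁴≤2^[8+m*k] : ∀ n m k → n ^ 4 ≤ 2 ^ m → (4 * n ^ k) ^ 4 ≤ 2 ^ (8 + m * k)
[4*n^k]⁴≤2^[8+m*k] n m k n⁴≤2^m = begin
  (4 * n ^ k) ^ 4      ≡⟨ solve 1 (λ x → (con 4 :* x) :^ 4 := con 256 :* x :^ 4) refl (n ^ k) ⟩
  256 * (n ^ k) ^ 4    ≡⟨ cong (256 *_) (trans (^-*-assoc n k 4) (trans (cong (n ^_) (*-comm k 4)) (sym (^-*-assoc n 4 k)))) ⟩
  256 * (n ^ 4) ^ k    ≤⟨ *-monoʳ-≤ 256 (^-monoˡ-≤ k n⁴≤2^m) ⟩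
  2 ^ 8 * (2 ^ m) ^ k  ≡⟨ cong (2 ^ 8 *_) (^-*-assoc 2 m k) ⟩
  2 ^ 8 * 2 ^ (m * k)  ≡⟨ ^-distribˡ-+-* 2 8 (m * k) ⟨
  2 ^ (8 + m * k)      ∎
  where open ≤-Reasoning

n⁴≤2^m⇒3≤m : ∀ {n m} → 2 ≤ n → n ^ 4 ≤ 2 ^ m → 3 ≤ m
n⁴≤2^m⇒3≤m {n} {m} 2≤n n⁴≤2^m with m ≤? 2
... | no m≰2 = ≰⇒> m≰2
... | yes m≤2 = contradiction n⁴≤2^m (<⇒≱ (begin-strict
  2 ^ m  ≤⟨ ^-monoʳ-≤ 2 m≤2 ⟩
  2 ^ 2  <⟨ ^-monoʳ-< 2 ≤-refl {2} {4} (s≤s (s≤s (s≤s z≤n))) ⟩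
  2 ^ 4  ≤⟨ ^-monoˡ-≤ 4 2≤n ⟩
  n ^ 4  ∎))
  where open ≤-Reasoning

4*n^[2+m]<weight : ∀ n m N → 3 ≤ m → n ^ 4 ≤ 2 ^ m → 2 * N + (2 + m) ≡ (2 + m) * (2 + m) →
                    4 * n ^ (2 + m) < weight N
4*n^[2+m]<weight n (suc (suc (suc t))) N (s≤s (s≤s (s≤s _))) n⁴≤2^m e =
  ≰⇒> λ w≤b → <⇒≱ fourth-powers (^-monoˡ-≤ 4 w≤b)
  where
  fourth-powers : (4 * n ^ (5 + t)) ^ 4 < weight N ^ 4
  fourth-powers = begin-strict
    (4 * n ^ (5 + t)) ^ 4         ≤⟨ [4*n^k]⁴≤2^[8+m*k] n (3 + t) (5 + t) n⁴≤2^m ⟩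
    2 ^ (8 + (3 + t) * (5 + t))   <⟨ ^-monoʳ-< 2 ≤-refl (8+[3+t][5+t]<2N+4 t N e) ⟩
    2 ^ (2 * N + 4)               ≤⟨ 2^[2c+4]≤weight⁴ N ⟩
    weight N ^ 4                  ∎
    where open ≤-Reasoning

module _ {A : Set} (f g : A → ℕ) where

  sum-map-mono : ∀ {xs} → All (λ a → f a ≤ g a) xs → sum (map f xs) ≤ sum (map g xs)
  sum-map-mono []         = z≤n
  sum-map-mono (fa≤ga ∷ ps) = +-mono-≤ fa≤ga (sum-map-mono ps)

  sum-map-+ : ∀ xs → sum (map (λ a → f a + g a) xs) ≡ sum (map f xs) + sum (map g xs)
  sum-map-+ []       = refl
  sum-map-+ (a ∷ xs) = begin
    f a + g a + sum (map (λ a → f a + g a) xs)   ≡⟨ cong (f a + g a +_) (sum-map-+ xs) ⟩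
    f a + g a + (sum (map f xs) + sum (map g xs)) ≡⟨ interchange (f a) (g a) (sum (map f xs)) (sum (map g xs)) ⟩
    f a + sum (map f xs) + (g a + sum (map g xs)) ∎
    where open ≡-Reasoning

  ∈⇒≤sum-map : ∀ {x xs} → x ∈ xs → f x ≤ sum (map f xs)
  ∈⇒≤sum-map (here refl) = m≤m+n _ _
  ∈⇒≤sum-map {xs = y ∷ xs} (there x∈xs) = ≤-trans (∈⇒≤sum-map x∈xs) (m≤n+m _ (f y))

sum-map-≤-length : ∀ {A : Set} (f : A → ℕ) {c} → (∀ a → f a ≤ c) → ∀ xs → sum (map f xs) ≤ length xs * c
sum-map-≤-length f f≤c []       = z≤n
sum-map-≤-length f f≤c (a ∷ xs) = +-mono-≤ (f≤c a) (sum-map-≤-length f f≤c xs)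

module _ {A : Set} {P Q : Pred A 0ℓ} (P? : Decidable P) (Q? : Decidable Q) (Q⇒P : ∀ {x} → Q x → P x) where

  length-filter-mono : ∀ xs → length (filter Q? xs) ≤ length (filter P? xs)
  length-filter-mono xs = Sublist.length-mono-≤ (Sublist.filter⁺ Q? P? (λ { refl → Q⇒P }) (Sublist.⊆-refl {x = xs}))

  length-filter-< : ∀ {x} xs → x ∈ xs → P x → ¬ Q x → length (filter Q? xs) < length (filter P? xs)
  length-filter-< (y ∷ xs) (here refl) py ¬qy with Q? y | P? y
  ... | yes qy | _      = contradiction qy ¬qy
  ... | no _   | yes _  = s≤s (length-filter-mono xs)
  ... | no _   | no ¬py = contradiction py ¬py
  length-filter-< (y ∷ xs) (there x∈xs) px ¬qx with Q? y | P? y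
  ... | yes _  | yes _  = s≤s (length-filter-< xs x∈xs px ¬qx)
  ... | yes qy | no ¬py = contradiction (Q⇒P qy) ¬py
  ... | no _   | yes _  = m<n⇒m<1+n (length-filter-< xs x∈xs px ¬qx)
  ... | no _   | no _   = length-filter-< xs x∈xs px ¬qx

module _ {A : Set} {P : Pred A 0ℓ} (P? : Decidable P) (g : A → ℕ) where

  maximise : ∀ xs → All (∁ P) xs ⊎ ∃ λ z → P z × (∀ {y} → y ∈ xs → P y → g y ≤ g z)
  maximise xs with filter P? xs in eq
  ... | [] = inj₁ (All.tabulate λ y∈xs py → ¬Any[] (subst (_ ∈_) eq (∈-filter⁺ P? y∈xs py)))
  ... | z ∷ zs with pz ∷ pzs ← subst (All P) eq (all-filter P? xs) =
    inj₂ (argmax g z zs , argmax-all g pz pzs , λ y∈xs py → bound (subst (_ ∈_) eq (∈-filter⁺ P? y∈xs py)))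
    where
    bound : ∀ {y} → y ∈ z ∷ zs → g y ≤ g (argmax g z zs)
    bound (here refl)  = f[⊥]≤f[argmax] {f = g} z zs
    bound (there y∈zs) = All.lookup (f[xs]≤f[argmax] {f = g} z zs) y∈zs

x+x≤y+z⇒x<w : ∀ {x y z w} → x + x ≤ y + z → y < w → z < w → x < w
x+x≤y+z⇒x<w x+x≤y+z y<w z<w =
  ≰⇒> λ w≤x → <⇒≱ (+-mono-< y<w z<w) (≤-trans (+-mono-≤ w≤x w≤x) x+x≤y+z)

module _ {A B : Set} {f : A → B} where

  Unique-map⁺-on : ∀ {xs} → (∀ {x y} → x ∈ xs → y ∈ xs → f x ≡ f y → x ≡ y) → Unique xs → Unique (map f xs)
  Unique-map⁺-on inj []         = []
  Unique-map⁺-on inj (x∉xs ∷ u) =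
    All.map⁺ (All.tabulate λ y∈xs fx≡fy → All.lookup x∉xs y∈xs (inj (here refl) (there y∈xs) fx≡fy))
    ∷ Unique-map⁺-on (λ x∈ y∈ → inj (there x∈) (there y∈)) u

length-cartesianProductWith : ∀ {A B C : Set} (f : A → B → C) xs ys →
                              length (cartesianProductWith f xs ys) ≡ length xs * length ys
length-cartesianProductWith f []       ys = refl
length-cartesianProductWith f (x ∷ xs) ys = begin
  length (map (f x) ys ++ cartesianProductWith f xs ys)
    ≡⟨ length-++ (map (f x) ys) ⟩
  length (map (f x) ys) + length (cartesianProductWith f xs ys)
    ≡⟨ cong₂ _+_ (length-map (f x) ys) (length-cartesianProductWith f xs ys) ⟩
  length ys + length xs * length ys
    ∎
  where open ≡-Reasoning

length-allFin : ∀ n → length (allFin n) ≡ n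
length-allFin n = length-tabulate {n = n} (λ i → i)

allVecs : ∀ k n → List (Vec (Fin n) k)
allVecs zero    n = [ [] ]
allVecs (suc k) n = cartesianProductWith _∷_ (allFin n) (allVecs k n)

length-allVecs : ∀ k n → length (allVecs k n) ≡ n ^ k
length-allVecs zero    n = refl
length-allVecs (suc k) n = begin
  length (cartesianProductWith _∷_ (allFin n) (allVecs k n)) ≡⟨ length-cartesianProductWith _∷_ (allFin n) (allVecs k n) ⟩
  length (allFin n) * length (allVecs k n)                 ≡⟨ cong₂ _*_ (length-allFin n) (length-allVecs k n) ⟩
  n * n ^ k                                                ∎
  where open ≡-Reasoning

∈-allVecs : ∀ {k n} (v : Vec (Fin n) k) → v ∈ allVecs k n
∈-allVecs []      = here refl
∈-allVecs (a ∷ v) = ∈-cartesianProductWith⁺ _∷_ (∈-allFin a) (∈-allVecs v)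

module Potential {X : Set} (_≟_ : DecidableEquality X) where

  open import Data.List.Membership.DecPropositional _≟_ using (_∈?_)

  χ : X → List X → ℕ
  χ x A with x ∈? A
  ... | yes _ = 1
  ... | no  _ = 0

  χ-∈ : ∀ {x A} → x ∈ A → χ x A ≡ 1
  χ-∈ {x} {A} x∈A with x ∈? A
  ... | yes _   = refl
  ... | no x∉A = contradiction x∈A x∉A

  χ-∉ : ∀ {x A} → x ∉ A → χ x A ≡ 0
  χ-∉ {x} {A} x∉A with x ∈? A
  ... | yes x∈A = contradiction x∈A x∉A
  ... | no _    = refl

  χ≤1 : ∀ x A → χ x A ≤ 1
  χ≤1 x A with x ∈? A
  ... | yes _ = ≤-refl
  ... | no  _ = z≤n

  χ-∷-≢ : ∀ {x y A} → x ≢ y → χ x (y ∷ A) ≡ χ x A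
  χ-∷-≢ {x} {y} {A} x≢y = by-cases (x ∈? A)
    where
    by-cases : Dec (x ∈ A) → χ x (y ∷ A) ≡ χ x A
    by-cases (yes x∈A) = trans (χ-∈ (there x∈A)) (sym (χ-∈ x∈A))
    by-cases (no x∉A)  = trans (χ-∉ λ { (here x≡y) → x≢y x≡y ; (there x∈A) → x∉A x∈A }) (sym (χ-∉ x∉A))

  claimed : List X → List X → ℕ
  claimed M A = sum (map (λ a → χ a M) A)

  claimed-∷ : ∀ {x M A} → Unique A → claimed (x ∷ M) A ≤ χ x A + claimed M A
  claimed-∷ {A = []} [] = z≤n
  claimed-∷ {x} {M} {a ∷ A} (a∉A ∷ uA) = by-cases (a ≟ x)
    where
    open ≤-Reasoning
    by-cases : Dec (a ≡ x) → claimed (x ∷ M) (a ∷ A) ≤ χ x (a ∷ A) + claimed M (a ∷ A)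
    by-cases (yes refl) = begin
      χ a (a ∷ M) + claimed (a ∷ M) A  ≡⟨ cong (_+ claimed (a ∷ M) A) (χ-∈ (here refl)) ⟩
      1 + claimed (a ∷ M) A            ≤⟨ s≤s (claimed-∷ uA) ⟩
      1 + (χ a A + claimed M A)        ≡⟨ cong (λ c → 1 + (c + claimed M A)) (χ-∉ (All¬⇒¬Any a∉A)) ⟩
      1 + claimed M A                  ≤⟨ s≤s (m≤n+m _ (χ a M)) ⟩
      1 + (χ a M + claimed M A)        ≡⟨ cong (_+ (χ a M + claimed M A)) (χ-∈ (here refl)) ⟨
      χ a (a ∷ A) + claimed M (a ∷ A)  ∎
    by-cases (no a≢x) = begin
      χ a (x ∷ M) + claimed (x ∷ M) A  ≤⟨ +-mono-≤ (≤-reflexive (χ-∷-≢ a≢x)) (claimed-∷ uA) ⟩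
      χ a M + (χ x A + claimed M A)    ≡⟨ x∙yz≈y∙xz (χ a M) (χ x A) (claimed M A) ⟩
      χ x A + (χ a M + claimed M A)    ≡⟨ cong (_+ claimed M (a ∷ A)) (χ-∷-≢ (a≢x ∘ sym)) ⟨
      χ x (a ∷ A) + claimed M (a ∷ A)  ∎

  claimed-[] : ∀ A → claimed [] A ≡ 0
  claimed-[] []      = refl
  claimed-[] (a ∷ A) = cong₂ _+_ (χ-∉ {a} {[]} λ ()) (claimed-[] A)

  claimed-⊆ : ∀ {M A} → All (_∈ M) A → claimed M A ≡ length A
  claimed-⊆ []            = refl
  claimed-⊆ (a∈M ∷ A⊆M) = cong₂ _+_ (χ-∈ a∈M) (claimed-⊆ A⊆M)

  Blocked : List X → List X → Set
  Blocked B A = Any (_∈ B) A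

  value : List X → List X → List X → ℕ
  value M B A with any? (_∈? B) A
  ... | yes _ = 0
  ... | no  _ = weight (claimed M A)

  dangerIn : List X → List X → X → List X → ℕ
  dangerIn M B x A = χ x A * value M B A

  dangerIn≤value : ∀ M B x A → dangerIn M B x A ≤ value M B A
  dangerIn≤value M B x A = ≤-trans (*-monoˡ-≤ (value M B A) (χ≤1 x A)) (≤-reflexive (*-identityˡ (value M B A)))

  value-blocked : ∀ {M B A} → Blocked B A → value M B A ≡ 0
  value-blocked {M} {B} {A} blocked with any? (_∈? B) A
  ... | yes _         = refl
  ... | no unblocked = contradiction blocked unblocked

  value-open : ∀ {M B A} → ¬ Blocked B A → value M B A ≡ weight (claimed M A)
  value-open {M} {B} {A} unblocked with any? (_∈? B) A
  ... | yes blocked = contradiction blocked unblocked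
  ... | no _        = refl

  value≤weight : ∀ M B A → value M B A ≤ weight (claimed M A)
  value≤weight M B A with any? (_∈? B) A
  ... | yes _ = z≤n
  ... | no  _ = ≤-refl

  value-claim₁ : ∀ {x M B A} → Unique A → value (x ∷ M) B A ≤ value M B A + dangerIn M B x A
  value-claim₁ {x} {M} {B} {A} uA with any? (_∈? B) A
  ... | yes _ = z≤n
  ... | no  _ = begin
    weight (claimed (x ∷ M) A)     ≤⟨ weight-mono-≤ (claimed-∷ uA) ⟩
    weight (χ x A + claimed M A)   ≤⟨ weight-claim₁ (claimed M A) (χ≤1 x A) ⟩
    weight (claimed M A) + χ x A * weight (claimed M A) ∎
    where open ≤-Reasoning

  value-claim₂ : ∀ {x y M B A} → Unique A →
                 value (x ∷ y ∷ M) B A + value (x ∷ y ∷ M) B A ≤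
                 (value M B A + dangerIn M B x A) + (value M B A + dangerIn M B y A)
  value-claim₂ {x} {y} {M} {B} {A} uA with any? (_∈? B) A
  ... | yes _ = z≤n
  ... | no  _ = begin
    weight c₂ + weight c₂                     ≤⟨ +-mono-≤ (weight-mono-≤ c₂≤) (weight-mono-≤ c₂≤) ⟩
    weight (χ x A + (χ y A + c)) + weight (χ x A + (χ y A + c))
                                              ≤⟨ weight-claim₂ c (χ≤1 x A) (χ≤1 y A) ⟩
    (weight c + χ x A * weight c) + (weight c + χ y A * weight c) ∎
    where
    open ≤-Reasoning
    c  = claimed M A
    c₂ = claimed (x ∷ y ∷ M) A
    c₂≤ : c₂ ≤ χ x A + (χ y A + c)
    c₂≤ = ≤-trans (claimed-∷ uA) (+-monoʳ-≤ (χ x A) (claimed-∷ uA))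

  unblock : ∀ {z B A} → z ∉ A → Blocked (z ∷ B) A → Blocked B A
  unblock z∉A (here (here refl)) = contradiction (here refl) z∉A
  unblock z∉A (here (there a∈B)) = here a∈B
  unblock z∉A (there blocked)    = there (unblock (z∉A ∘ there) blocked)

  value-∷-∉ : ∀ {M B z A} → z ∉ A → value M (z ∷ B) A ≡ value M B A
  value-∷-∉ {M} {B} {z} {A} z∉A with any? (_∈? B) A
  ... | yes blocked   = value-blocked (Any.map there blocked)
  ... | no unblocked = value-open (unblocked ∘ unblock z∉A)

  value-block : ∀ M B z A → value M (z ∷ B) A + dangerIn M B z A ≡ value M B A
  value-block M B z A = by-cases (z ∈? A)
    where
    by-cases : Dec (z ∈ A) → value M (z ∷ B) A + dangerIn M B z A ≡ value M B A
    by-cases (yes z∈A) = begin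
      value M (z ∷ B) A + χ z A * value M B A ≡⟨ cong₂ _+_ (value-blocked (Any.map (λ z≡a → here (sym z≡a)) z∈A))
                                                             (cong (_* value M B A) (χ-∈ z∈A)) ⟩
      0 + 1 * value M B A                     ≡⟨ *-identityˡ (value M B A) ⟩
      value M B A                             ∎
      where open ≡-Reasoning
    by-cases (no z∉A) = begin
      value M (z ∷ B) A + χ z A * value M B A ≡⟨ cong₂ _+_ (value-∷-∉ z∉A) (cong (_* value M B A) (χ-∉ z∉A)) ⟩
      value M B A + 0                         ≡⟨ +-identityʳ (value M B A) ⟩
      value M B A                             ∎
      where open ≡-Reasoning

  value-block-≤ : ∀ M B z A → value M (z ∷ B) A ≤ value M B A
  value-block-≤ M B z A = ≤-trans (m≤m+n _ _) (≤-reflexive (value-block M B z A))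

  module _ (W : List (List X)) where

    potential : List X → List X → ℕ
    potential M B = sum (map (value M B) W)

    danger : List X → List X → X → ℕ
    danger M B x = sum (map (dangerIn M B x) W)

    potential-full : ∀ {M B A} → A ∈ W → All (_∈ M) A → ¬ Blocked B A → weight (length A) ≤ potential M B
    potential-full {M} {B} {A} A∈W A⊆M unblocked = begin
      weight (length A)   ≡⟨ cong weight (claimed-⊆ A⊆M) ⟨
      weight (claimed M A) ≡⟨ value-open unblocked ⟨
      value M B A         ≤⟨ ∈⇒≤sum-map (value M B) (value M B) A∈W ⟩
      potential M B       ∎
      where open ≤-Reasoning

    potential-start : potential [] [] ≤ length W * 2
    potential-start =
      sum-map-≤-length (value [] []) (λ A → ≤-trans (value≤weight [] [] A) (≤-reflexive (cong weight (claimed-[] A)))) W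

    danger≤potential : ∀ M B x → danger M B x ≤ potential M B
    danger≤potential M B x = sum-map-mono (dangerIn M B x) (value M B) (All.universal (dangerIn≤value M B x) W)

    potential-block : ∀ M B z → potential M (z ∷ B) + danger M B z ≡ potential M B
    potential-block M B z = begin
      potential M (z ∷ B) + danger M B z              ≡⟨ sum-map-+ (value M (z ∷ B)) (dangerIn M B z) W ⟨
      sum (map (λ A → value M (z ∷ B) A + dangerIn M B z A) W) ≡⟨ cong sum (map-cong (value-block M B z) W) ⟩
      potential M B                                   ∎
      where open ≡-Reasoning

    danger-block : ∀ M B z y → danger M (z ∷ B) y ≤ danger M B y
    danger-block M B z y = sum-map-mono (dangerIn M (z ∷ B) y) (dangerIn M B y)
      (All.universal (λ A → *-monoʳ-≤ (χ y A) (value-block-≤ M B z A)) W)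

    module _ (W-unique : All Unique W) where

      potential-claim₁ : ∀ x M B → potential (x ∷ M) B ≤ potential M B + danger M B x
      potential-claim₁ x M B = begin
        potential (x ∷ M) B ≤⟨ sum-map-mono (value (x ∷ M) B) _ (All.map value-claim₁ W-unique) ⟩
        sum (map (λ A → value M B A + dangerIn M B x A) W) ≡⟨ sum-map-+ (value M B) (dangerIn M B x) W ⟩
        potential M B + danger M B x ∎
        where open ≤-Reasoning

      potential-claim₂ : ∀ x y M B → potential (x ∷ y ∷ M) B + potential (x ∷ y ∷ M) B ≤
                                     (potential M B + danger M B x) + (potential M B + danger M B y)
      potential-claim₂ x y M B = begin
        potential (x ∷ y ∷ M) B + potential (x ∷ y ∷ M) B
          ≡⟨ sum-map-+ (value (x ∷ y ∷ M) B) (value (x ∷ y ∷ M) B) W ⟨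
        sum (map (λ A → value (x ∷ y ∷ M) B A + value (x ∷ y ∷ M) B A) W)
          ≤⟨ sum-map-mono _ _ (All.map value-claim₂ W-unique) ⟩
        sum (map (λ A → (value M B A + dangerIn M B x A) + (value M B A + dangerIn M B y A)) W)
          ≡⟨ sum-map-+ (λ A → value M B A + dangerIn M B x A) (λ A → value M B A + dangerIn M B y A) W ⟩
        sum (map (λ A → value M B A + dangerIn M B x A) W) + sum (map (λ A → value M B A + dangerIn M B y A) W)
          ≡⟨ cong₂ _+_ (sum-map-+ (value M B) (dangerIn M B x) W) (sum-map-+ (value M B) (dangerIn M B y) W) ⟩
        (potential M B + danger M B x) + (potential M B + danger M B y) ∎
        where open ≤-Reasoning

_≟ₚ_ : ∀ {n} → DecidableEquality (Pair n)
_≟ₚ_ = ≡-dec _≟_ _≟_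

module _ {n : ℕ} where

  Free-anti : ∀ {M M′ B B′ z} → M ⊆ M′ → B ⊆ B′ → Free {n} M′ B′ z → Free M B z
  Free-anti M⊆M′ B⊆B′ (z-board , z∉M′ , z∉B′) = z-board , z∉M′ ∘ M⊆M′ , z∉B′ ∘ B⊆B′

  open import Data.List.Membership.DecPropositional (_≟ₚ_ {n}) using (_∈?_)

  free? : ∀ M B → Decidable (Free M B)
  free? M B (u , v) = ¬? (u ≟ v) ×-dec ¬? ((u , v) ∈? M) ×-dec ¬? ((u , v) ∈? B)

  allPairs : List (Pair n)
  allPairs = cartesianProduct (allFin n) (allFin n)

  ∈-allPairs : ∀ x → x ∈ allPairs
  ∈-allPairs (u , v) = ∈-cartesianProduct⁺ (∈-allFin u) (∈-allFin v)

  freeCount : List (Pair n) → List (Pair n) → ℕ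
  freeCount M B = length (filter (free? M B) allPairs)

  freeCount-anti : ∀ {M M′ B B′} → M ⊆ M′ → B ⊆ B′ → freeCount M′ B′ ≤ freeCount M B
  freeCount-anti M⊆M′ B⊆B′ = length-filter-mono (free? _ _) (free? _ _) (Free-anti M⊆M′ B⊆B′) allPairs

  freeCount-claim : ∀ {M M′ B x} → M ⊆ M′ → x ∈ M′ → Free M B x → freeCount M′ B < freeCount M B
  freeCount-claim M⊆M′ x∈M′ x-free =
    length-filter-< (free? _ _) (free? _ _) (Free-anti M⊆M′ id) allPairs (∈-allPairs _) x-free
                    (λ (_ , x∉M′ , _) → x∉M′ x∈M′)

  freeCount≤0⇒¬Free : ∀ {M B x} → freeCount M B ≤ 0 → ¬ Free M B x
  freeCount≤0⇒¬Free {x = x} count≤0 x-free = <⇒≱ (filter-some (free? _ _) (lose (∈-allPairs x) x-free)) count≤0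

module BreakerStrategy {k n} (T : Tournament k) (W : List (List (Pair n))) (W-unique : All Unique W) (N : ℕ)
  (copy⇒full : ∀ {M} → ContainsCopy T M → ∃ λ A → A ∈ W × All (_∈ M) A × length A ≡ N) where

  open Potential (_≟ₚ_ {n}) using (potential; danger; potential-full; potential-start; danger≤potential;
                             potential-block; danger-block; potential-claim₁; potential-claim₂)

  Φ : List (Pair n) → List (Pair n) → ℕ
  Φ = potential W

  D : List (Pair n) → List (Pair n) → Pair n → ℕ
  D = danger W

  Safe : List (Pair n) → List (Pair n) → Set
  Safe M B = ∀ z → Free M B z → Φ M B + D M B z < weight N

  copy⇒weight≤Φ : ∀ {M B} → Disjoint M B → ContainsCopy T M → weight N ≤ Φ M B
  copy⇒weight≤Φ {M} {B} M∩B=∅ copy with A , A∈W , A⊆M , refl ← copy⇒full copy =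
    potential-full W A∈W A⊆M (All¬⇒¬Any (All.map (λ a∈M a∈B → M∩B=∅ (a∈M , a∈B)) A⊆M))

  claim-disjoint : ∀ {M B : List (Pair n)} {x} → x ∉ B → Disjoint M B → Disjoint (x ∷ M) B
  claim-disjoint x∉B M∩B=∅ (here refl , x∈B) = x∉B x∈B
  claim-disjoint _   M∩B=∅ (there v∈M , v∈B) = M∩B=∅ (v∈M , v∈B)

  block-disjoint : ∀ {M B : List (Pair n)} {z} → z ∉ M → Disjoint M B → Disjoint M (z ∷ B)
  block-disjoint z∉M M∩B=∅ (z∈M , here refl)  = z∉M z∈M
  block-disjoint _   M∩B=∅ (v∈M , there v∈B) = M∩B=∅ (v∈M , v∈B)

  mutual
    breakerWins : ∀ fuel {M B} → freeCount M B ≤ fuel → Disjoint M B → Safe M B → BreakerWins T M B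
    breakerWins zero    count≤0 _ _ =
      node (λ _ _ x-free _ _ → contradiction x-free (freeCount≤0⇒¬Free count≤0))
           (λ _ x-free _ → contradiction x-free (freeCount≤0⇒¬Free count≤0))
    breakerWins (suc fuel) {M} {B} count≤ M∩B=∅ safe = node claim-two claim-one
      where
      claim-two : ∀ x y → Free M B x → Free M B y → x ≢ y → AfterMaker T (x ∷ y ∷ M) B
      claim-two x y x-free y-free _ =
        afterMaker fuel (≤-pred (<-≤-trans (freeCount-claim {M′ = x ∷ y ∷ M} (there ∘ there) (here refl) x-free) count≤))
          (claim-disjoint (proj₂ (proj₂ x-free)) (claim-disjoint (proj₂ (proj₂ y-free)) M∩B=∅))
          (x+x≤y+z⇒x<w (potential-claim₂ W W-unique x y M B) (safe x x-free) (safe y y-free))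
      claim-one : ∀ x → Free M B x → (∀ z → Free M B z → z ≡ x) → AfterMaker T (x ∷ M) B
      claim-one x x-free _ =
        afterMaker fuel (≤-pred (<-≤-trans (freeCount-claim {M′ = x ∷ M} there (here refl) x-free) count≤))
          (claim-disjoint (proj₂ (proj₂ x-free)) M∩B=∅)
          (≤-<-trans (potential-claim₁ W W-unique x M B) (safe x x-free))

    afterMaker : ∀ fuel {M B} → freeCount M B ≤ fuel → Disjoint M B → Φ M B < weight N → AfterMaker T M B
    afterMaker fuel {M} {B} count≤ M∩B=∅ Φ<weight with maximise (free? M B) (D M B) allPairs
    ... | inj₁ none-free = full no-copy (λ x → All.lookup none-free (∈-allPairs x))
      where no-copy = λ copy → <⇒≱ Φ<weight (copy⇒weight≤Φ M∩B=∅ copy)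
    ... | inj₂ (z , z-free , z-max) =
      reply no-copy z z-free (breakerWins fuel (≤-trans (freeCount-anti {M = M} {B′ = z ∷ B} id there) count≤)
                                           (block-disjoint (proj₁ (proj₂ z-free)) M∩B=∅) safe)
      where
      no-copy = λ copy → <⇒≱ Φ<weight (copy⇒weight≤Φ M∩B=∅ copy)
      safe : Safe M (z ∷ B)
      safe y y-free = begin-strict
        Φ M (z ∷ B) + D M (z ∷ B) y ≤⟨ +-monoʳ-≤ (Φ M (z ∷ B)) (danger-block W M B z y) ⟩
        Φ M (z ∷ B) + D M B y       ≤⟨ +-monoʳ-≤ (Φ M (z ∷ B)) (z-max (∈-allPairs y) (Free-anti id there y-free)) ⟩
        Φ M (z ∷ B) + D M B z       ≡⟨ potential-block W M B z ⟩
        Φ M B                       <⟨ Φ<weight ⟩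
        weight N                    ∎
        where open ≤-Reasoning

  breakerWinsH : 4 * length W < weight N → BreakerWinsH T n
  breakerWinsH 4|W|<weight = breakerWins (freeCount {n} [] []) ≤-refl (λ ()) safe
    where
    safe : Safe [] []
    safe z _ = begin-strict
      Φ [] [] + D [] [] z         ≤⟨ +-monoʳ-≤ (Φ [] []) (danger≤potential W [] [] z) ⟩
      Φ [] [] + Φ [] []           ≤⟨ +-mono-≤ (potential-start W) (potential-start W) ⟩
      length W * 2 + length W * 2 ≡⟨ solve 1 (λ l → l :* con 2 :+ l :* con 2 := con 4 :* l) refl (length W) ⟩
      4 * length W                <⟨ 4|W|<weight ⟩
      weight N                    ∎
      where open ≤-Reasoning

ascendingPairs : ∀ k → List (Fin k × Fin k)
ascendingPairs zero    = []
ascendingPairs (suc k) = map (λ j → zero , suc j) (allFin k) ++ map (Product.map suc suc) (ascendingPairs k)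

ascendingPairs-< : ∀ {k p} → p ∈ ascendingPairs k → proj₁ p <ᶠ proj₂ p
ascendingPairs-< {suc k} p∈ with ∈-++⁻ (map (λ j → zero , suc j) (allFin k)) p∈
... | inj₁ p∈₁ with _ , _ , refl ← ∈-map⁻ (λ j → zero , suc j) p∈₁ = s≤s z≤n
... | inj₂ p∈₂ with _ , q∈ , refl ← ∈-map⁻ (Product.map suc suc) p∈₂ = s≤s (ascendingPairs-< q∈)

ascendingPairs-≢-swap : ∀ {k p q} → p ∈ ascendingPairs k → q ∈ ascendingPairs k → p ≢ swap q
ascendingPairs-≢-swap p∈ q∈ refl = <-asym (ascendingPairs-< p∈) (ascendingPairs-< q∈)

ascendingPairs-unique : ∀ k → Unique (ascendingPairs k)
ascendingPairs-unique zero    = []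
ascendingPairs-unique (suc k) =
  Unique.++⁺ (Unique.map⁺ (suc-injective ∘ proj₂ ∘ ,-injective) (Unique.allFin⁺ k))
             (Unique.map⁺ (λ e → let e₁ , e₂ = ,-injective e in cong₂ _,_ (suc-injective e₁) (suc-injective e₂))
                          (ascendingPairs-unique k))
             first≢rest
  where
  first≢rest : ∀ {p} → ¬ (p ∈ map (λ j → zero , suc j) (allFin k) × p ∈ map (Product.map suc suc) (ascendingPairs k))
  first≢rest (p∈₁ , p∈₂) with _ , _ , refl ← ∈-map⁻ (λ j → zero , suc j) p∈₁
                           | _ , _ , () ← ∈-map⁻ (Product.map suc suc) p∈₂

length-ascendingPairs : ∀ k → 2 * length (ascendingPairs k) + k ≡ k * k
length-ascendingPairs zero    = refl
length-ascendingPairs (suc k) = begin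
  2 * length (ascendingPairs (suc k)) + suc k ≡⟨ cong (λ l → 2 * l + suc k) length-step ⟩
  2 * (k + L) + suc k
    ≡⟨ solve 2 (λ k L → con 2 :* (k :+ L) :+ (con 1 :+ k) := (con 2 :* L :+ k) :+ (con 2 :* k :+ con 1)) refl k L ⟩
  (2 * L + k) + (2 * k + 1)                   ≡⟨ cong (_+ (2 * k + 1)) (length-ascendingPairs k) ⟩
  k * k + (2 * k + 1)
    ≡⟨ solve 1 (λ k → k :* k :+ (con 2 :* k :+ con 1) := (con 1 :+ k) :* (con 1 :+ k)) refl k ⟩
  suc k * suc k                               ∎
  where
  open ≡-Reasoning
  L = length (ascendingPairs k)
  length-step : length (ascendingPairs (suc k)) ≡ k + L
  length-step = trans (length-++ (map (λ j → zero , suc j) (allFin k)))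
                      (cong₂ _+_ (trans (length-map _ (allFin k)) (length-allFin k)) (length-map _ (ascendingPairs k)))

module _ {k} (T : Tournament k) where

  orient : Fin k × Fin k → Fin k × Fin k
  orient (a , b) with a ≟ b
  ... | yes _ = a , b
  ... | no a≢b with total T a b a≢b
  ...   | inj₁ _ = a , b
  ...   | inj₂ _ = b , a

  orient-arc : ∀ {a b} → a ≢ b → Arc T (proj₁ (orient (a , b))) (proj₂ (orient (a , b)))
  orient-arc {a} {b} a≢b with a ≟ b
  ... | yes a≡b = contradiction a≡b a≢b
  ... | no a≢b′ with total T a b a≢b′
  ...   | inj₁ ab = ab
  ...   | inj₂ ba = ba

  orient-either : ∀ p → orient p ≡ p ⊎ orient p ≡ swap p
  orient-either (a , b) with a ≟ b
  ... | yes _ = inj₁ refl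
  ... | no a≢b with total T a b a≢b
  ...   | inj₁ _ = inj₁ refl
  ...   | inj₂ _ = inj₂ refl

  orient-injective : ∀ {p q} → p ∈ ascendingPairs k → q ∈ ascendingPairs k → orient p ≡ orient q → p ≡ q
  orient-injective {p} {q} p∈ q∈ e with orient-either p | orient-either q
  ... | inj₁ o₁ | inj₁ o₂ = trans (sym o₁) (trans e o₂)
  ... | inj₂ o₁ | inj₂ o₂ = cong swap (trans (sym o₁) (trans e o₂))
  ... | inj₁ o₁ | inj₂ o₂ = contradiction (trans (sym o₁) (trans e o₂)) (ascendingPairs-≢-swap p∈ q∈)
  ... | inj₂ o₁ | inj₁ o₂ = contradiction (trans (sym o₂) (trans (sym e) o₁)) (ascendingPairs-≢-swap q∈ p∈)

  arcs : List (Fin k × Fin k)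
  arcs = map orient (ascendingPairs k)

  arcs-arc : ∀ {p} → p ∈ arcs → Arc T (proj₁ p) (proj₂ p)
  arcs-arc p∈ with q , q∈ , refl ← ∈-map⁻ orient p∈ =
    orient-arc (λ q₁≡q₂ → <-irrefl q₁≡q₂ (ascendingPairs-< q∈))

  length-arcs : 2 * length arcs + k ≡ k * k
  length-arcs = trans (cong (λ l → 2 * l + k) (length-map orient (ascendingPairs k))) (length-ascendingPairs k)

  arcs-unique : Unique arcs
  arcs-unique = Unique-map⁺-on orient-injective (ascendingPairs-unique k)

  module _ (n : ℕ) where

    copySet : Vec (Fin n) k → List (Pair n)
    copySet v = map (Product.map (lookup v) (lookup v)) arcs

    -- Filtering by Unique keeps the images of all injective v, which is all copy⇒copySet needs.
    copySets : List (List (Pair n))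
    copySets = filter (unique? _≟ₚ_) (map copySet (allVecs k n))

    copySets-unique : All Unique copySets
    copySets-unique = all-filter (unique? _≟ₚ_) (map copySet (allVecs k n))

    length-copySets : length copySets ≤ n ^ k
    length-copySets = ≤-trans (length-filter (unique? _≟ₚ_) (map copySet (allVecs k n)))
                              (≤-reflexive (trans (length-map copySet (allVecs k n)) (length-allVecs k n)))

    copy⇒copySet : ∀ {M} → ContainsCopy T M →
                   ∃ λ A → A ∈ copySets × All (_∈ M) A × length A ≡ length arcs
    copy⇒copySet {M} (φ , φ-injective , φ-arcs) = A , A∈copySets , A⊆M , length-map _ arcs
      where
      v = tabulate φ
      lookup-v : ∀ a → lookup v a ≡ φ a
      lookup-v = lookup∘tabulate φ
      A = copySet v
      lookup-v-injective : ∀ {a b} → lookup v a ≡ lookup v b → a ≡ b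
      lookup-v-injective e = φ-injective (trans (sym (lookup-v _)) (trans e (lookup-v _)))
      A-unique : Unique A
      A-unique = Unique.map⁺ (λ e → let e₁ , e₂ = ,-injective e in
                                    cong₂ _,_ (lookup-v-injective e₁) (lookup-v-injective e₂))
                             arcs-unique
      A∈copySets : A ∈ copySets
      A∈copySets = ∈-filter⁺ (unique? _≟ₚ_) (∈-map⁺ copySet (∈-allVecs v)) A-unique
      A⊆M : All (_∈ M) A
      A⊆M = All.map⁺ (All.tabulate λ {(a , b)} ab∈arcs →
              subst (_∈ M) (sym (cong₂ _,_ (lookup-v a) (lookup-v b))) (φ-arcs a b (arcs-arc ab∈arcs)))

claim1 : Σ ℕ λ n₀ → ∀ n → n₀ ≤ n → ∀ k → 2 ≤ k → n ^ 4 ≤ 2 ^ (k ∸ 2)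
           → (T : Tournament k) → BreakerWinsH T n
claim1 = 2 , breakerWins
  where
  breakerWins : ∀ n → 2 ≤ n → ∀ k → 2 ≤ k → n ^ 4 ≤ 2 ^ (k ∸ 2) → (T : Tournament k) → BreakerWinsH T n
  breakerWins n 2≤n (suc (suc m)) (s≤s (s≤s _)) n⁴≤2^m T =
    BreakerStrategy.breakerWinsH T (copySets T n) (copySets-unique T n) N (copy⇒copySet T n)
      (begin-strict
        4 * length (copySets T n) ≤⟨ *-monoʳ-≤ 4 (length-copySets T n) ⟩
        4 * n ^ (2 + m)           <⟨ 4*n^[2+m]<weight n m N (n⁴≤2^m⇒3≤m 2≤n n⁴≤2^m) n⁴≤2^m (length-arcs T) ⟩
        weight N                  ∎)
    where
    open ≤-Reasoning
    N = length (arcs T)
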